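{- Let $a\in\mathbb{Z}$ with $3\nmid a$, and let $f_a(x) = -8ax^3-(8a+2)x^2+(4a-1)x+a$. Then the reduction of $f_a$ modulo $3$ is irreducible over $\mathbb{Z}/3$, and consequently $f_a$ is irreducible in $\mathbb{Z}[x]$. -}

module Defs where

open import Level using (0ℓ)
open import Data.Nat as ℕ using (ℕ; zero; suc; _≤_; _∸_)
open import Data.Fin as Fin using (Fin; toℕ)
open import Data.Integer as ℤ using (ℤ; +_; -[1+_])
open import Data.Product using (∃; _×_)
open import Data.Sum using (_⊎_)
open import Relation.Nullary using (¬_)
open import Relation.Binary.PropositionalEquality using (_≡_)
open import Algebra.Bundles.Raw using (RawRing)

-- Univariate polynomials over a (raw) ring R, represented by their
-- coefficient sequences ℕ → R with finite support.

module PolyOver {c ℓ} (R : RawRing c ℓ) where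
  open RawRing R

  Poly : Set c
  Poly = ℕ → Carrier

  IsPoly : Poly → Set ℓ
  IsPoly p = ∃ λ N → ∀ n → N ≤ n → p n ≈ 0#

  _≈ₚ_ : Poly → Poly → Set ℓ
  p ≈ₚ q = ∀ n → p n ≈ q n

  0ₚ : Poly
  0ₚ _ = 0#

  1ₚ : Poly
  1ₚ zero    = 1#
  1ₚ (suc _) = 0#

  sumTo : (ℕ → Carrier) → ℕ → Carrier
  sumTo f zero    = f zero
  sumTo f (suc n) = sumTo f n + f (suc n)

  _·ₚ_ : Poly → Poly → Poly
  (p ·ₚ q) n = sumTo (λ i → p i * q (n ∸ i)) n

  IsUnit : Poly → Set (c Level.⊔ ℓ)
  IsUnit p = ∃ λ q → IsPoly q × ((p ·ₚ q) ≈ₚ 1ₚ)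

  Irreducible : Poly → Set (c Level.⊔ ℓ)
  Irreducible p =
    ¬ (p ≈ₚ 0ₚ) × ¬ IsUnit p ×
    (∀ (g h : Poly) → IsPoly g → IsPoly h → p ≈ₚ (g ·ₚ h) → IsUnit g ⊎ IsUnit h)

reduceℕ : ℕ → Fin 3
reduceℕ 0 = Fin.zero
reduceℕ 1 = Fin.suc Fin.zero
reduceℕ 2 = Fin.suc (Fin.suc Fin.zero)
reduceℕ (suc (suc (suc n))) = reduceℕ n

_+₃_ : Fin 3 → Fin 3 → Fin 3
x +₃ y = reduceℕ (toℕ x ℕ.+ toℕ y)

_*₃_ : Fin 3 → Fin 3 → Fin 3
x *₃ y = reduceℕ (toℕ x ℕ.* toℕ y)

-₃_ : Fin 3 → Fin 3
-₃ x = reduceℕ (3 ∸ toℕ x)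

ℤ/3 : RawRing 0ℓ 0ℓ
ℤ/3 = record
  { Carrier = Fin 3
  ; _≈_ = _≡_
  ; _+_ = _+₃_
  ; _*_ = _*₃_
  ; -_ = -₃_
  ; 0# = reduceℕ 0
  ; 1# = reduceℕ 1
  }

reduceℤ : ℤ → Fin 3
reduceℤ (+ n)      = reduceℕ n
reduceℤ -[1+ n ]   = -₃ reduceℕ (suc n)

f : ℤ → ℕ → ℤ
f a 0 = a
f a 1 = + 4 ℤ.* a ℤ.- + 1
f a 2 = ℤ.- (+ 8 ℤ.* a ℤ.+ + 2)
f a 3 = ℤ.- (+ 8 ℤ.* a)
f a (suc (suc (suc (suc _)))) = + 0

f̄ : ℤ → ℕ → Fin 3
f̄ a n = reduceℤ (f a n)

module ℤ[x]   = PolyOver ℤ.+-*-rawRing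
module ℤ/3[x] = PolyOver ℤ/3

-- Over ℤ/3 a cubic with a nontrivial factorisation has one whose factors both have degree at
-- most 2, so irreducibility of the reduction f̄_a is a finite search, which only depends on
-- a mod 3 ∈ {1, 2}. Over ℤ, the leading coefficient -8a of f_a is a unit mod 3, so reduction
-- preserves the degrees of the factors of any factorisation f_a = g h; irreducibility mod 3
-- then forces one factor, say g, to be a constant c. Such a c divides both a and 4a - 1, hence
-- divides 1 and is a unit.
module Submission where

open import Defs
open import Data.Integer using (ℤ; +_)
open import Data.Integer.Divisibility using (_∣_)
open import Data.Product using (_×_)
open import Relation.Nullary using (¬_)

open import Level using (0ℓ)
open import Function using (_∘_)
open import Data.Empty using (⊥; ⊥-elim)
open import Data.Product using (∃; _,_; proj₁; proj₂)
open import Data.Sum as Sum using (_⊎_; inj₁; inj₂; [_,_]′)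
open import Data.Nat as ℕ using (ℕ; zero; suc; _≤_; _<_; _∸_; z≤n; s≤s)
import Data.Nat.Properties as ℕP
open import Data.Fin as Fin using (Fin; toℕ)
open import Data.Fin.Properties using (all?)
open import Data.Integer using (-[1+_]; _+_; _*_; _-_; -_; _/ℕ_; _%ℕ_)
import Data.Integer as ℤ
import Data.Integer.Properties as ℤP
open import Data.Integer.DivMod using (a≡a%ℕn+[a/ℕn]*n; n%ℕd<d)
open import Data.Integer.Divisibility.Signed using (divides; ∣⇒∣ᵤ)
open import Data.Integer.Tactic.RingSolver using (solve-∀)
open import Relation.Nullary using (Dec; yes; no)
open import Relation.Nullary.Decidable using (from-yes; _×-dec_; _⊎-dec_; _→-dec_)
open import Relation.Binary.Definitions using (DecidableEquality; tri<; tri≈; tri>)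
open import Relation.Binary.PropositionalEquality
open import Algebra.Core using (Op₁; Op₂)
open import Algebra.Bundles.Raw using (RawRing)

m+n<o⇒m<o∸n : ∀ m n {o} → m ℕ.+ n < o → m < o ∸ n
m+n<o⇒m<o∸n m n = ℕP.m+n≤o⇒m≤o∸n (suc m)

+-≤-≡⇒≡ : ∀ {m n o p} → m ≤ o → n ≤ p → m ℕ.+ n ≡ o ℕ.+ p → m ≡ o × n ≡ p
+-≤-≡⇒≡ {m} {n} {o} {p} m≤o n≤p m+n≡o+p =
  m≡o , ℕP.+-cancelˡ-≡ m n p (trans m+n≡o+p (cong (ℕ._+ p) (sym m≡o)))
  where
  open ℕP.≤-Reasoning
  m≡o : m ≡ o
  m≡o = ℕP.≤-antisym m≤o (ℕP.+-cancelʳ-≤ p o m (begin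
    o ℕ.+ p ≡⟨ m+n≡o+p ⟨
    m ℕ.+ n ≤⟨ ℕP.+-monoʳ-≤ m n≤p ⟩
    m ℕ.+ p ∎))

-- The ring is passed by its operations, with _≡_ as equality, so that `PolyOver ring` is
-- definitionally `PolyOver ℤ/3` resp. `PolyOver ℤ.+-*-rawRing` for the instances below.
module Degrees {A : Set} (_+_ _*_ : Op₂ A) (-_ : Op₁ A) (0# 1# : A)
  (_≟_ : DecidableEquality A)
  (+-identityˡ : ∀ x → 0# + x ≡ x) (+-identityʳ : ∀ x → x + 0# ≡ x)
  (*-zeroˡ : ∀ x → 0# * x ≡ 0#) (*-zeroʳ : ∀ x → x * 0# ≡ 0#)
  (zero-divisor : ∀ x {y} → x * y ≡ 0# → x ≡ 0# ⊎ y ≡ 0#)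
  (1≢0 : 1# ≢ 0#)
  where

  ring : RawRing 0ℓ 0ℓ
  ring = record
    { Carrier = A ; _≈_ = _≡_ ; _+_ = _+_ ; _*_ = _*_ ; -_ = -_ ; 0# = 0# ; 1# = 1# }

  open PolyOver ring

  VanishesAbove : Poly → ℕ → Set
  VanishesAbove p d = ∀ n → d < n → p n ≡ 0#

  HasDegree : Poly → ℕ → Set
  HasDegree p d = p d ≢ 0# × VanishesAbove p d

  vanishesAbove-mono : ∀ {p d d′} → d ≤ d′ → VanishesAbove p d → VanishesAbove p d′
  vanishesAbove-mono d≤d′ p≡0 n d′<n = p≡0 n (ℕP.≤-<-trans d≤d′ d′<n)

  zero⊎degree : ∀ p → IsPoly p → p ≈ₚ 0ₚ ⊎ ∃ (HasDegree p)
  zero⊎degree p (N , vanishes) = search N vanishes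
    where
    search : ∀ N → (∀ n → N ≤ n → p n ≡ 0#) → p ≈ₚ 0ₚ ⊎ ∃ (HasDegree p)
    search zero    p≡0 = inj₁ λ n → p≡0 n z≤n
    search (suc M) p≡0 with p M ≟ 0#
    ... | no  pM≢0 = inj₂ (M , pM≢0 , p≡0)
    ... | yes pM≡0 =
      search M λ n M≤n → [ p≡0 n , (λ { refl → pM≡0 }) ]′ (ℕP.m≤n⇒m<n∨m≡n M≤n)

  degree-unique : ∀ {p q d e} → HasDegree p d → HasDegree q e → p ≈ₚ q → d ≡ e
  degree-unique {p} {q} {d} {e} (pd≢0 , p≡0) (qe≢0 , q≡0) p≈q with ℕP.<-cmp d e
  ... | tri< d<e _ _ = ⊥-elim (qe≢0 (trans (sym (p≈q e)) (p≡0 e d<e)))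
  ... | tri≈ _ d≡e _ = d≡e
  ... | tri> _ _ e<d = ⊥-elim (pd≢0 (trans (p≈q d) (q≡0 d e<d)))

  degree⇒≉0ₚ : ∀ {p d} → HasDegree p d → ¬ (p ≈ₚ 0ₚ)
  degree⇒≉0ₚ {d = d} (pd≢0 , _) p≈0 = pd≢0 (p≈0 d)

  1ₚ-degree : HasDegree 1ₚ 0
  1ₚ-degree = 1≢0 , λ { (suc _) _ → refl }

  sumTo-zero : ∀ t n → (∀ i → i ≤ n → t i ≡ 0#) → sumTo t n ≡ 0#
  sumTo-zero t zero    t≡0 = t≡0 0 z≤n
  sumTo-zero t (suc n) t≡0 = begin
    sumTo t n + t (suc n) ≡⟨ cong₂ _+_ (sumTo-zero t n λ i i≤n → t≡0 i (ℕP.m≤n⇒m≤1+n i≤n))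
                                       (t≡0 (suc n) ℕP.≤-refl) ⟩
    0# + 0#               ≡⟨ +-identityʳ 0# ⟩
    0#                    ∎
    where open ≡-Reasoning

  sumTo-single : ∀ t n k → k ≤ n → (∀ i → i ≤ n → i ≢ k → t i ≡ 0#) → sumTo t n ≡ t k
  sumTo-single t zero    .zero z≤n _   = refl
  sumTo-single t (suc n) k     k≤1+n t≡0 with ℕP.m≤n⇒m<n∨m≡n k≤1+n
  ... | inj₂ refl = begin
    sumTo t n + t k ≡⟨ cong (_+ t k) (sumTo-zero t n λ i i≤n →
                         t≡0 i (ℕP.m≤n⇒m≤1+n i≤n) (ℕP.<⇒≢ (s≤s i≤n))) ⟩
    0# + t k        ≡⟨ +-identityˡ (t k) ⟩
    t k             ∎
    where open ≡-Reasoning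
  ... | inj₁ (s≤s k≤n) = begin
    sumTo t n + t (suc n) ≡⟨ cong₂ _+_ (sumTo-single t n k k≤n λ i i≤n →
                                          t≡0 i (ℕP.m≤n⇒m≤1+n i≤n))
                                       (t≡0 (suc n) ℕP.≤-refl (≢-sym (ℕP.<⇒≢ (s≤s k≤n)))) ⟩
    t k + 0#              ≡⟨ +-identityʳ (t k) ⟩
    t k                   ∎
    where open ≡-Reasoning

  sumTo-cong : ∀ t u n → (∀ i → t i ≡ u i) → sumTo t n ≡ sumTo u n
  sumTo-cong t u zero    t≡u = t≡u 0
  sumTo-cong t u (suc n) t≡u = cong₂ _+_ (sumTo-cong t u n t≡u) (t≡u (suc n))

  ·ₚ-cong : ∀ {p q r s} → p ≈ₚ q → r ≈ₚ s → (p ·ₚ r) ≈ₚ (q ·ₚ s)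
  ·ₚ-cong p≈q r≈s n = sumTo-cong _ _ n λ i → cong₂ _*_ (p≈q i) (r≈s (n ∸ i))

  ·ₚ-zeroˡ : ∀ p q → p ≈ₚ 0ₚ → (p ·ₚ q) ≈ₚ 0ₚ
  ·ₚ-zeroˡ p q p≈0 n =
    sumTo-zero _ n λ i _ → trans (cong (_* q (n ∸ i)) (p≈0 i)) (*-zeroˡ _)

  ·ₚ-zeroʳ : ∀ p q → q ≈ₚ 0ₚ → (p ·ₚ q) ≈ₚ 0ₚ
  ·ₚ-zeroʳ p q q≈0 n =
    sumTo-zero _ n λ i _ → trans (cong (p i *_) (q≈0 (n ∸ i))) (*-zeroʳ _)

  ·ₚ-vanishesAbove : ∀ {p q d e} → VanishesAbove p d → VanishesAbove q e →
                     VanishesAbove (p ·ₚ q) (d ℕ.+ e)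
  ·ₚ-vanishesAbove {p} {q} {d} {e} p≡0 q≡0 n d+e<n = sumTo-zero _ n term
    where
    term : ∀ i → i ≤ n → p i * q (n ∸ i) ≡ 0#
    term i _ with d ℕP.<? i
    ... | yes d<i = trans (cong (_* q (n ∸ i)) (p≡0 i d<i)) (*-zeroˡ _)
    ... | no  d≮i = trans (cong (p i *_) (q≡0 (n ∸ i) e<n∸i)) (*-zeroʳ _)
      where
      e<n∸i : e < n ∸ i
      e<n∸i = m+n<o⇒m<o∸n e i (ℕP.≤-<-trans (ℕP.+-monoʳ-≤ e (ℕP.≮⇒≥ d≮i))
                                 (subst (_< n) (ℕP.+-comm d e) d+e<n))

  ·ₚ-leading : ∀ {p q d e} → VanishesAbove p d → VanishesAbove q e →
               (p ·ₚ q) (d ℕ.+ e) ≡ p d * q e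
  ·ₚ-leading {p} {q} {d} {e} p≡0 q≡0 = begin
    sumTo (λ i → p i * q (d ℕ.+ e ∸ i)) (d ℕ.+ e)
      ≡⟨ sumTo-single _ (d ℕ.+ e) d (ℕP.m≤m+n d e) off-diagonal ⟩
    p d * q (d ℕ.+ e ∸ d)
      ≡⟨ cong (λ j → p d * q j) (ℕP.m+n∸m≡n d e) ⟩
    p d * q e ∎
    where
    open ≡-Reasoning
    off-diagonal : ∀ i → i ≤ d ℕ.+ e → i ≢ d → p i * q (d ℕ.+ e ∸ i) ≡ 0#
    off-diagonal i _ i≢d with ℕP.<-cmp i d
    ... | tri≈ _ i≡d _ = ⊥-elim (i≢d i≡d)
    ... | tri> _ _ d<i = trans (cong (_* _) (p≡0 i d<i)) (*-zeroˡ _)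
    ... | tri< i<d _ _ = trans (cong (p i *_) (q≡0 _ e<d+e∸i)) (*-zeroʳ _)
      where
      e<d+e∸i : e < d ℕ.+ e ∸ i
      e<d+e∸i = m+n<o⇒m<o∸n e i (subst (_< d ℕ.+ e) (ℕP.+-comm i e) (ℕP.+-monoˡ-< e i<d))

  ·ₚ-degree : ∀ {p q d e} → HasDegree p d → HasDegree q e →
              HasDegree (p ·ₚ q) (d ℕ.+ e)
  ·ₚ-degree {p} (pd≢0 , p≡0) (qe≢0 , q≡0) =
    (λ pq≡0 → [ pd≢0 , qe≢0 ]′ (zero-divisor _ (trans (sym (·ₚ-leading p≡0 q≡0)) pq≡0))) ,
    ·ₚ-vanishesAbove p≡0 q≡0

  degree-· : ∀ {F t p q} → HasDegree F t → IsPoly p → IsPoly q → F ≈ₚ (p ·ₚ q) →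
             ∃ λ d → ∃ λ e → HasDegree p d × HasDegree q e × d ℕ.+ e ≡ t
  degree-· {F} {t} {p} {q} F-deg@(Ft≢0 , _) p-poly q-poly F≈pq
    with zero⊎degree p p-poly | zero⊎degree q q-poly
  ... | inj₁ p≈0 | _        = ⊥-elim (Ft≢0 (trans (F≈pq t) (·ₚ-zeroˡ p q p≈0 t)))
  ... | inj₂ _   | inj₁ q≈0 = ⊥-elim (Ft≢0 (trans (F≈pq t) (·ₚ-zeroʳ p q q≈0 t)))
  ... | inj₂ (d , p-deg) | inj₂ (e , q-deg) =
    d , e , p-deg , q-deg , degree-unique (·ₚ-degree p-deg q-deg) F-deg (λ n → sym (F≈pq n))

  ·ₚ-constantˡ : ∀ {p} q → VanishesAbove p 0 → ∀ n → (p ·ₚ q) n ≡ p 0 * q n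
  ·ₚ-constantˡ {p} q p≡0 n = sumTo-single _ n 0 z≤n off-constant
    where
    off-constant : ∀ i → i ≤ n → i ≢ 0 → p i * q (n ∸ i) ≡ 0#
    off-constant zero    _ i≢0 = ⊥-elim (i≢0 refl)
    off-constant (suc i) _ _   =
      trans (cong (_* q (n ∸ suc i)) (p≡0 (suc i) (s≤s z≤n))) (*-zeroˡ _)

  ·ₚ-constantʳ : ∀ p {q} → VanishesAbove q 0 → ∀ n → (p ·ₚ q) n ≡ p n * q 0
  ·ₚ-constantʳ p {q} q≡0 n = begin
    (p ·ₚ q) n      ≡⟨ sumTo-single _ n n ℕP.≤-refl off-constant ⟩
    p n * q (n ∸ n) ≡⟨ cong (λ j → p n * q j) (ℕP.n∸n≡0 n) ⟩
    p n * q 0       ∎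
    where
    open ≡-Reasoning
    off-constant : ∀ i → i ≤ n → i ≢ n → p i * q (n ∸ i) ≡ 0#
    off-constant i i≤n i≢n =
      trans (cong (p i *_) (q≡0 (n ∸ i) (ℕP.m<n⇒0<n∸m (ℕP.≤∧≢⇒< i≤n i≢n)))) (*-zeroʳ _)

  constant-isUnit : ∀ {p} c → VanishesAbove p 0 → p 0 * c ≡ 1# → IsUnit p
  constant-isUnit {p} c p≡0 p0*c≡1 = const-c , (1 , const-c≡0) , p·c≈1
    where
    const-c : Poly
    const-c zero    = c
    const-c (suc _) = 0#
    const-c≡0 : ∀ n → 1 ≤ n → const-c n ≡ 0#
    const-c≡0 (suc _) _ = refl
    p·c≈1 : (p ·ₚ const-c) ≈ₚ 1ₚ
    p·c≈1 zero    = p0*c≡1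
    p·c≈1 (suc n) = ·ₚ-vanishesAbove p≡0 const-c≡0 (suc n) (s≤s z≤n)

  positive-degree⇒¬isUnit : ∀ {p t} → HasDegree p (suc t) → ¬ IsUnit p
  positive-degree⇒¬isUnit {p} p-deg (q , q-poly , pq≈1) with zero⊎degree q q-poly
  ... | inj₁ q≈0 = 1≢0 (trans (sym (pq≈1 0)) (·ₚ-zeroʳ p q q≈0 0))
  ... | inj₂ (e , q-deg) with degree-unique (·ₚ-degree p-deg q-deg) 1ₚ-degree pq≈1
  ...   | ()

  isUnit⇒degree-0 : ∀ {p d} → HasDegree p d → IsUnit p → d ≡ 0
  isUnit⇒degree-0 {d = zero}  _     _      = refl
  isUnit⇒degree-0 {d = suc _} p-deg p-unit = ⊥-elim (positive-degree⇒¬isUnit p-deg p-unit)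

pattern 𝟘 = Fin.zero
pattern 𝟙 = Fin.suc Fin.zero
pattern 𝟚 = Fin.suc (Fin.suc Fin.zero)

+₃-identityˡ : ∀ x → 𝟘 +₃ x ≡ x
+₃-identityˡ 𝟘 = refl
+₃-identityˡ 𝟙 = refl
+₃-identityˡ 𝟚 = refl

+₃-identityʳ : ∀ x → x +₃ 𝟘 ≡ x
+₃-identityʳ 𝟘 = refl
+₃-identityʳ 𝟙 = refl
+₃-identityʳ 𝟚 = refl

*₃-zeroˡ : ∀ x → 𝟘 *₃ x ≡ 𝟘
*₃-zeroˡ _ = refl

*₃-zeroʳ : ∀ x → x *₃ 𝟘 ≡ 𝟘
*₃-zeroʳ 𝟘 = refl
*₃-zeroʳ 𝟙 = refl
*₃-zeroʳ 𝟚 = refl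

*₃-zero-divisor : ∀ x {y} → x *₃ y ≡ 𝟘 → x ≡ 𝟘 ⊎ y ≡ 𝟘
*₃-zero-divisor 𝟘 {_} _  = inj₁ refl
*₃-zero-divisor 𝟙 {𝟘} _  = inj₂ refl
*₃-zero-divisor 𝟚 {𝟘} _  = inj₂ refl
*₃-zero-divisor 𝟙 {𝟙} ()
*₃-zero-divisor 𝟙 {𝟚} ()
*₃-zero-divisor 𝟚 {𝟙} ()
*₃-zero-divisor 𝟚 {𝟚} ()

*₃-self-inverse : ∀ x → x ≢ 𝟘 → x *₃ x ≡ 𝟙
*₃-self-inverse 𝟘 x≢0 = ⊥-elim (x≢0 refl)
*₃-self-inverse 𝟙 _   = refl
*₃-self-inverse 𝟚 _   = refl

module ℤ/3-Degrees = Degrees _+₃_ _*₃_ -₃_ 𝟘 𝟙 Fin._≟_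
  +₃-identityˡ +₃-identityʳ *₃-zeroˡ *₃-zeroʳ *₃-zero-divisor (λ ())

module ℤ-Degrees = Degrees _+_ _*_ -_ (+ 0) (+ 1) ℤ._≟_
  ℤP.+-identityˡ ℤP.+-identityʳ ℤP.*-zeroˡ ℤP.*-zeroʳ ℤP.i*j≡0⇒i≡0∨j≡0 (λ ())

open ℤ/3[x] using () renaming (_≈ₚ_ to _≈₃_; _·ₚ_ to _·₃_)
open ℤ[x] using () renaming (_≈ₚ_ to _≈ℤ_; _·ₚ_ to _·ℤ_)
open ℤ/3-Degrees using () renaming (HasDegree to HasDegree₃)
open ℤ-Degrees using () renaming (HasDegree to HasDegreeℤ; VanishesAbove to VanishesAboveℤ)

degree-0⇒isUnit₃ : ∀ {p} → HasDegree₃ p 0 → ℤ/3[x].IsUnit p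
degree-0⇒isUnit₃ {p} (p0≢0 , p≡0) =
  ℤ/3-Degrees.constant-isUnit (p 0) p≡0 (*₃-self-inverse (p 0) p0≢0)

reduceℕ-+3 : ∀ n → reduceℕ (n ℕ.+ 3) ≡ reduceℕ n
reduceℕ-+3 0 = refl
reduceℕ-+3 1 = refl
reduceℕ-+3 2 = refl
reduceℕ-+3 (suc (suc (suc n))) = reduceℕ-+3 n

reduceℤ-+3 : ∀ x → reduceℤ (x + + 3) ≡ reduceℤ x
reduceℤ-+3 (+ n)                    = reduceℕ-+3 n
reduceℤ-+3 -[1+ 0 ]                 = refl
reduceℤ-+3 -[1+ 1 ]                 = refl
reduceℤ-+3 -[1+ 2 ]                 = refl
reduceℤ-+3 -[1+ suc (suc (suc n)) ] = refl

reduceℤ-+-*3 : ∀ x k → reduceℤ (x + k * + 3) ≡ reduceℤ x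
reduceℤ-+-*3 x (+ m) = +-*3 m
  where
  +-*3 : ∀ m → reduceℤ (x + + m * + 3) ≡ reduceℤ x
  +-*3 zero    = cong reduceℤ (ℤP.+-identityʳ x)
  +-*3 (suc m) = begin
    reduceℤ (x + + suc m * + 3)     ≡⟨ cong reduceℤ (shift x (+ m)) ⟩
    reduceℤ ((x + + m * + 3) + + 3) ≡⟨ reduceℤ-+3 (x + + m * + 3) ⟩
    reduceℤ (x + + m * + 3)         ≡⟨ +-*3 m ⟩
    reduceℤ x                       ∎
    where
    open ≡-Reasoning
    shift : ∀ x m → x + (+ 1 + m) * + 3 ≡ (x + m * + 3) + + 3
    shift = solve-∀
reduceℤ-+-*3 x k@(-[1+ m ]) = begin
  reduceℤ (x + k * + 3)                 ≡⟨ reduceℤ-+-*3 (x + k * + 3) (+ suc m) ⟨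
  reduceℤ ((x + k * + 3) + (- k) * + 3) ≡⟨ cong reduceℤ (cancel x k) ⟩
  reduceℤ x                             ∎
  where
  open ≡-Reasoning
  cancel : ∀ x k → (x + k * + 3) + (- k) * + 3 ≡ x
  cancel = solve-∀

toℕ-reduceℕ : ∀ m → m < 3 → toℕ (reduceℕ m) ≡ m
toℕ-reduceℕ 0 _ = refl
toℕ-reduceℕ 1 _ = refl
toℕ-reduceℕ 2 _ = refl
toℕ-reduceℕ (suc (suc (suc _))) (s≤s (s≤s (s≤s ())))

residue : ℤ → ℤ
residue x = + toℕ (reduceℤ x)

residue+quotient : ∀ x → x ≡ residue x + (x /ℕ 3) * + 3
residue+quotient x = trans x≡r+q*3 (cong (λ r → + r + x /ℕ 3 * + 3) (sym reduce≡r))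
  where
  x≡r+q*3 : x ≡ + (x %ℕ 3) + (x /ℕ 3) * + 3
  x≡r+q*3 = a≡a%ℕn+[a/ℕn]*n x 3
  reduce≡r : toℕ (reduceℤ x) ≡ x %ℕ 3
  reduce≡r = begin
    toℕ (reduceℤ x)                             ≡⟨ cong (toℕ ∘ reduceℤ) x≡r+q*3 ⟩
    toℕ (reduceℤ (+ (x %ℕ 3) + (x /ℕ 3) * + 3)) ≡⟨ cong toℕ (reduceℤ-+-*3 (+ (x %ℕ 3)) (x /ℕ 3)) ⟩
    toℕ (reduceℕ (x %ℕ 3))                      ≡⟨ toℕ-reduceℕ _ (n%ℕd<d x 3) ⟩
    x %ℕ 3                                      ∎
    where open ≡-Reasoning

reduceℤ≡0⇒3∣ : ∀ a → reduceℤ a ≡ 𝟘 → + 3 ∣ a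
reduceℤ≡0⇒3∣ a reduce≡0 = ∣⇒∣ᵤ (divides (a /ℕ 3) (begin
  a                                ≡⟨ residue+quotient a ⟩
  + toℕ (reduceℤ a) + a /ℕ 3 * + 3 ≡⟨ cong (λ r → + toℕ r + a /ℕ 3 * + 3) reduce≡0 ⟩
  + 0 + a /ℕ 3 * + 3               ≡⟨ ℤP.+-identityˡ _ ⟩
  a /ℕ 3 * + 3                     ∎))
  where open ≡-Reasoning

reduceℤ-+ : ∀ x y → reduceℤ (x + y) ≡ reduceℤ x +₃ reduceℤ y
reduceℤ-+ x y = begin
  reduceℤ (x + y)
    ≡⟨ cong reduceℤ (cong₂ _+_ (residue+quotient x) (residue+quotient y)) ⟩
  reduceℤ ((rx + qx * + 3) + (ry + qy * + 3))
    ≡⟨ cong reduceℤ (regroup rx qx ry qy) ⟩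
  reduceℤ ((rx + ry) + (qx + qy) * + 3)
    ≡⟨ reduceℤ-+-*3 (rx + ry) (qx + qy) ⟩
  reduceℤ (rx + ry)
    ≡⟨⟩
  reduceℤ x +₃ reduceℤ y ∎
  where
  open ≡-Reasoning
  rx = residue x
  ry = residue y
  qx = x /ℕ 3
  qy = y /ℕ 3
  regroup : ∀ r q s p → (r + q * + 3) + (s + p * + 3) ≡ (r + s) + (q + p) * + 3
  regroup = solve-∀

reduceℤ-* : ∀ x y → reduceℤ (x * y) ≡ reduceℤ x *₃ reduceℤ y
reduceℤ-* x y = begin
  reduceℤ (x * y)
    ≡⟨ cong reduceℤ (cong₂ _*_ (residue+quotient x) (residue+quotient y)) ⟩
  reduceℤ ((rx + qx * + 3) * (ry + qy * + 3))
    ≡⟨ cong reduceℤ (regroup rx qx ry qy) ⟩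
  reduceℤ (rx * ry + (qx * ry + rx * qy + qx * qy * + 3) * + 3)
    ≡⟨ reduceℤ-+-*3 (rx * ry) (qx * ry + rx * qy + qx * qy * + 3) ⟩
  reduceℤ (rx * ry)
    ≡⟨ cong reduceℤ (ℤP.pos-* (toℕ (reduceℤ x)) (toℕ (reduceℤ y))) ⟨
  reduceℤ x *₃ reduceℤ y ∎
  where
  open ≡-Reasoning
  rx = residue x
  ry = residue y
  qx = x /ℕ 3
  qy = y /ℕ 3
  regroup : ∀ r q s p → (r + q * + 3) * (s + p * + 3) ≡
                        r * s + (q * s + r * p + q * p * + 3) * + 3
  regroup = solve-∀

reduce : (ℕ → ℤ) → (ℕ → Fin 3)
reduce p n = reduceℤ (p n)

reduce-isPoly : ∀ {p} → ℤ[x].IsPoly p → ℤ/3[x].IsPoly (reduce p)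
reduce-isPoly (N , p≡0) = N , λ n N≤n → cong reduceℤ (p≡0 n N≤n)

reduce-sumTo : ∀ t n → reduceℤ (ℤ[x].sumTo t n) ≡ ℤ/3[x].sumTo (reduce t) n
reduce-sumTo t zero    = refl
reduce-sumTo t (suc n) =
  trans (reduceℤ-+ (ℤ[x].sumTo t n) (t (suc n))) (cong (_+₃ reduce t (suc n)) (reduce-sumTo t n))

reduce-·ₚ : ∀ p q → reduce (p ·ℤ q) ≈₃ (reduce p ·₃ reduce q)
reduce-·ₚ p q n =
  trans (reduce-sumTo _ n) (ℤ/3-Degrees.sumTo-cong _ _ n λ i → reduceℤ-* (p i) (q (n ∸ i)))

reduce-factorisation : ∀ {F} p q → F ≈ℤ (p ·ℤ q) → reduce F ≈₃ (reduce p ·₃ reduce q)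
reduce-factorisation p q F≈pq n = trans (cong reduceℤ (F≈pq n)) (reduce-·ₚ p q n)

reduce-isUnit : ∀ p → ℤ[x].IsUnit p → ℤ/3[x].IsUnit (reduce p)
reduce-isUnit p (q , q-poly , pq≈1) = reduce q , reduce-isPoly q-poly , λ n →
  trans (sym (reduce-factorisation p q (sym ∘ pq≈1) n)) (reduce-1ₚ n)
  where
  reduce-1ₚ : reduce ℤ[x].1ₚ ≈₃ ℤ/3[x].1ₚ
  reduce-1ₚ zero    = refl
  reduce-1ₚ (suc _) = refl

reduce-degree≤ : ∀ {g d d′} → HasDegree₃ (reduce g) d′ → VanishesAboveℤ g d → d′ ≤ d
reduce-degree≤ {d = d} {d′} (gd′≢0 , _) g≡0 with d ℕP.<? d′
... | yes d<d′ = ⊥-elim (gd′≢0 (cong reduceℤ (g≡0 d′ d<d′)))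
... | no  d≮d′ = ℕP.≮⇒≥ d≮d′

quadratic : Fin 3 → Fin 3 → Fin 3 → ℕ → Fin 3
quadratic c₀ _  _  0 = c₀
quadratic _  c₁ _  1 = c₁
quadratic _  _  c₂ 2 = c₂
quadratic _  _  _  (suc (suc (suc _))) = 𝟘

-- Coefficient 4 is compared too: the product of two quadratics may have degree 4.
QuadraticSplittingsTrivial : (ℕ → Fin 3) → Set
QuadraticSplittingsTrivial P = ∀ g₀ g₁ g₂ h₀ h₁ h₂ →
  (∀ (i : Fin 5) → P (toℕ i) ≡ (quadratic g₀ g₁ g₂ ·₃ quadratic h₀ h₁ h₂) (toℕ i)) →
  (g₁ ≡ 𝟘 × g₂ ≡ 𝟘) ⊎ (h₁ ≡ 𝟘 × h₂ ≡ 𝟘)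

quadraticSplittingsTrivial? : ∀ P → Dec (QuadraticSplittingsTrivial P)
quadraticSplittingsTrivial? P =
  all? λ g₀ → all? λ g₁ → all? λ g₂ → all? λ h₀ → all? λ h₁ → all? λ h₂ →
    (all? λ i → P (toℕ i) Fin.≟ (quadratic g₀ g₁ g₂ ·₃ quadratic h₀ h₁ h₂) (toℕ i))
    →-dec ((g₁ Fin.≟ 𝟘 ×-dec g₂ Fin.≟ 𝟘) ⊎-dec (h₁ Fin.≟ 𝟘 ×-dec h₂ Fin.≟ 𝟘))

degree≤2⇒quadratic : ∀ {g d} → HasDegree₃ g d → d ≤ 2 → g ≈₃ quadratic (g 0) (g 1) (g 2)
degree≤2⇒quadratic _ _ 0 = refl
degree≤2⇒quadratic _ _ 1 = refl
degree≤2⇒quadratic _ _ 2 = refl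
degree≤2⇒quadratic (_ , g≡0) d≤2 n@(suc (suc (suc _))) =
  ℤ/3-Degrees.vanishesAbove-mono d≤2 g≡0 n (s≤s (s≤s (s≤s z≤n)))

positive-degree≤2⇒nonconstant : ∀ {g d} → HasDegree₃ g (suc d) → suc d ≤ 2 →
                                ¬ (g 1 ≡ 𝟘 × g 2 ≡ 𝟘)
positive-degree≤2⇒nonconstant {d = 0} (g1≢0 , _) _ (g1≡0 , _) = g1≢0 g1≡0
positive-degree≤2⇒nonconstant {d = 1} (g2≢0 , _) _ (_ , g2≡0) = g2≢0 g2≡0
positive-degree≤2⇒nonconstant {d = suc (suc _)} _ (s≤s (s≤s ())) _

module Cubic {P : ℕ → Fin 3} (P-splittings : QuadraticSplittingsTrivial P) where

  no-quadratic-factorisation : ∀ {g h d e} → P ≈₃ (g ·₃ h) →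
    HasDegree₃ g (suc d) → HasDegree₃ h (suc e) → suc d ≤ 2 → suc e ≤ 2 → ⊥
  no-quadratic-factorisation {g} {h} P≈gh g-deg h-deg d<2 e<2
    with P-splittings (g 0) (g 1) (g 2) (h 0) (h 1) (h 2) (λ i →
           trans (P≈gh (toℕ i)) (ℤ/3-Degrees.·ₚ-cong (degree≤2⇒quadratic g-deg d<2)
                                                    (degree≤2⇒quadratic h-deg e<2) (toℕ i)))
  ... | inj₁ g-constant = positive-degree≤2⇒nonconstant g-deg d<2 g-constant
  ... | inj₂ h-constant = positive-degree≤2⇒nonconstant h-deg e<2 h-constant

  factor-degrees : ∀ {g h d e} → P ≈₃ (g ·₃ h) →
    HasDegree₃ g d → HasDegree₃ h e → d ℕ.+ e ≡ 3 → d ≡ 0 ⊎ e ≡ 0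
  factor-degrees {d = 0} _ _ _ _    = inj₁ refl
  factor-degrees {d = 3} _ _ _ refl = inj₂ refl
  factor-degrees {d = 1} P≈gh g-deg h-deg refl =
    ⊥-elim (no-quadratic-factorisation P≈gh g-deg h-deg (s≤s z≤n) ℕP.≤-refl)
  factor-degrees {d = 2} P≈gh g-deg h-deg refl =
    ⊥-elim (no-quadratic-factorisation P≈gh g-deg h-deg ℕP.≤-refl (s≤s z≤n))
  factor-degrees {d = suc (suc (suc (suc _)))} _ _ _ ()

  irreducible : HasDegree₃ P 3 → ℤ/3[x].Irreducible P
  irreducible P-deg =
    ℤ/3-Degrees.degree⇒≉0ₚ P-deg , ℤ/3-Degrees.positive-degree⇒¬isUnit P-deg , factors-units
    where
    factors-units : ∀ g h → ℤ/3[x].IsPoly g → ℤ/3[x].IsPoly h → P ≈₃ (g ·₃ h) →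
                    ℤ/3[x].IsUnit g ⊎ ℤ/3[x].IsUnit h
    factors-units g h g-poly h-poly P≈gh with ℤ/3-Degrees.degree-· P-deg g-poly h-poly P≈gh
    ... | d , e , g-deg , h-deg , d+e≡3 with factor-degrees P≈gh g-deg h-deg d+e≡3
    ...   | inj₁ refl = inj₁ (degree-0⇒isUnit₃ g-deg)
    ...   | inj₂ refl = inj₂ (degree-0⇒isUnit₃ h-deg)

-- A common constant factor c of the coefficients is ±1, stated as c * c ≡ + 1 so that c is its
-- own inverse.
Primitive : (ℕ → ℤ) → Set
Primitive F = ∀ c (h : ℕ → ℤ) → (∀ n → F n ≡ c * h n) → c * c ≡ + 1

module Reduction {F : ℕ → ℤ} {t : ℕ}
  (F-primitive : Primitive F) (F-deg : HasDegreeℤ F t)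
  (F̄-deg : HasDegree₃ (reduce F) t) (F̄-irreducible : ℤ/3[x].Irreducible (reduce F))
  where

  constant-factorˡ : ∀ {g} h → VanishesAboveℤ g 0 → F ≈ℤ (g ·ℤ h) → ℤ[x].IsUnit g
  constant-factorˡ {g} h g≡0 F≈gh =
    ℤ-Degrees.constant-isUnit (g 0) g≡0 (F-primitive (g 0) h λ n →
      trans (F≈gh n) (ℤ-Degrees.·ₚ-constantˡ h g≡0 n))

  constant-factorʳ : ∀ {h} g → VanishesAboveℤ h 0 → F ≈ℤ (g ·ℤ h) → ℤ[x].IsUnit h
  constant-factorʳ {h} g h≡0 F≈gh =
    ℤ-Degrees.constant-isUnit (h 0) h≡0 (F-primitive (h 0) g λ n →
      trans (F≈gh n) (trans (ℤ-Degrees.·ₚ-constantʳ g h≡0 n) (ℤP.*-comm (g n) (h 0))))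

  reduced-factor-degrees : ∀ {g h} → ℤ[x].IsPoly g → ℤ[x].IsPoly h → F ≈ℤ (g ·ℤ h) →
    ∃ λ d → ∃ λ e → VanishesAboveℤ g d × VanishesAboveℤ h e ×
                    HasDegree₃ (reduce g) d × HasDegree₃ (reduce h) e
  reduced-factor-degrees {g} {h} g-poly h-poly F≈gh
    with ℤ-Degrees.degree-· F-deg g-poly h-poly F≈gh
       | ℤ/3-Degrees.degree-· F̄-deg (reduce-isPoly g-poly) (reduce-isPoly h-poly)
                                     (reduce-factorisation g h F≈gh)
  ... | d , e , (_ , g≡0) , (_ , h≡0) , d+e≡t | d̄ , ē , ḡ-deg , h̄-deg , d̄+ē≡t
    with +-≤-≡⇒≡ (reduce-degree≤ ḡ-deg g≡0) (reduce-degree≤ h̄-deg h≡0)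
                 (trans d̄+ē≡t (sym d+e≡t))
  ... | refl , refl = d , e , g≡0 , h≡0 , ḡ-deg , h̄-deg

  reduced-unit⇒constant : ∀ {g d} → VanishesAboveℤ g d → HasDegree₃ (reduce g) d →
                          ℤ/3[x].IsUnit (reduce g) → VanishesAboveℤ g 0
  reduced-unit⇒constant {g} g≡0 ḡ-deg ḡ-unit =
    subst (VanishesAboveℤ g) (ℤ/3-Degrees.isUnit⇒degree-0 ḡ-deg ḡ-unit) g≡0

  factors-units : ∀ g h → ℤ[x].IsPoly g → ℤ[x].IsPoly h → F ≈ℤ (g ·ℤ h) →
                  ℤ[x].IsUnit g ⊎ ℤ[x].IsUnit h
  factors-units g h g-poly h-poly F≈gh =
    let (_ , _ , g≡0 , h≡0 , ḡ-deg , h̄-deg) = reduced-factor-degrees g-poly h-poly F≈gh in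
    Sum.map (λ ḡ-unit → constant-factorˡ h (reduced-unit⇒constant g≡0 ḡ-deg ḡ-unit) F≈gh)
            (λ h̄-unit → constant-factorʳ g (reduced-unit⇒constant h≡0 h̄-deg h̄-unit) F≈gh)
            (proj₂ (proj₂ F̄-irreducible) (reduce g) (reduce h) (reduce-isPoly g-poly)
                                         (reduce-isPoly h-poly) (reduce-factorisation g h F≈gh))

  irreducible : ℤ[x].Irreducible F
  irreducible =
    ℤ-Degrees.degree⇒≉0ₚ F-deg ,
    (λ F-unit → proj₁ (proj₂ F̄-irreducible) (reduce-isUnit F F-unit)) ,
    factors-units

f-+-*3 : ∀ b k n → ∃ λ e → f (b + k * + 3) n ≡ f b n + e * + 3
f-+-*3 b k 0 = k , refl
f-+-*3 b k 1 = + 4 * k , expand b k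
  where
  expand : ∀ b k → + 4 * (b + k * + 3) - + 1 ≡ (+ 4 * b - + 1) + (+ 4 * k) * + 3
  expand = solve-∀
f-+-*3 b k 2 = - (+ 8 * k) , expand b k
  where
  expand : ∀ b k → - (+ 8 * (b + k * + 3) + + 2) ≡ - (+ 8 * b + + 2) + (- (+ 8 * k)) * + 3
  expand = solve-∀
f-+-*3 b k 3 = - (+ 8 * k) , expand b k
  where
  expand : ∀ b k → - (+ 8 * (b + k * + 3)) ≡ - (+ 8 * b) + (- (+ 8 * k)) * + 3
  expand = solve-∀
f-+-*3 b k (suc (suc (suc (suc _)))) = + 0 , refl

f̄-residue : ∀ a → f̄ a ≈₃ f̄ (residue a)
f̄-residue a n with f-+-*3 (residue a) (a /ℕ 3) n
... | e , f≡f+e*3 = begin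
  reduceℤ (f a n)                          ≡⟨ cong (reduceℤ ∘ (λ b → f b n)) (residue+quotient a) ⟩
  reduceℤ (f (residue a + a /ℕ 3 * + 3) n) ≡⟨ cong reduceℤ f≡f+e*3 ⟩
  reduceℤ (f (residue a) n + e * + 3)      ≡⟨ reduceℤ-+-*3 (f (residue a) n) e ⟩
  reduceℤ (f (residue a) n)                ∎
  where open ≡-Reasoning

f̄-residue-cases : ∀ a → ¬ (+ 3 ∣ a) → f̄ a ≈₃ f̄ (+ 1) ⊎ f̄ a ≈₃ f̄ (+ 2)
f̄-residue-cases a 3∤a with reduceℤ a in reduce≡r
... | 𝟘 = ⊥-elim (3∤a (reduceℤ≡0⇒3∣ a reduce≡r))
... | 𝟙 = inj₁ (subst (λ r → f̄ a ≈₃ f̄ (+ toℕ r)) reduce≡r (f̄-residue a))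
... | 𝟚 = inj₂ (subst (λ r → f̄ a ≈₃ f̄ (+ toℕ r)) reduce≡r (f̄-residue a))

f̄-quadraticSplittingsTrivial : ∀ a → ¬ (+ 3 ∣ a) → QuadraticSplittingsTrivial (f̄ a)
f̄-quadraticSplittingsTrivial a 3∤a g₀ g₁ g₂ h₀ h₁ h₂ f̄a≈gh with f̄-residue-cases a 3∤a
... | inj₁ f̄a≈f̄1 = from-yes (quadraticSplittingsTrivial? (f̄ (+ 1))) g₀ g₁ g₂ h₀ h₁ h₂
                      λ i → trans (sym (f̄a≈f̄1 (toℕ i))) (f̄a≈gh i)
... | inj₂ f̄a≈f̄2 = from-yes (quadraticSplittingsTrivial? (f̄ (+ 2))) g₀ g₁ g₂ h₀ h₁ h₂
                      λ i → trans (sym (f̄a≈f̄2 (toℕ i))) (f̄a≈gh i)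

f-vanishesAbove-3 : ∀ a → VanishesAboveℤ (f a) 3
f-vanishesAbove-3 a 0 ()
f-vanishesAbove-3 a 1 (s≤s ())
f-vanishesAbove-3 a 2 (s≤s (s≤s ()))
f-vanishesAbove-3 a 3 (s≤s (s≤s (s≤s ())))
f-vanishesAbove-3 a (suc (suc (suc (suc _)))) _ = refl

f̄-degree : ∀ a → ¬ (+ 3 ∣ a) → HasDegree₃ (f̄ a) 3
f̄-degree a 3∤a =
  leading (f̄-residue-cases a 3∤a) , λ n 3<n → cong reduceℤ (f-vanishesAbove-3 a n 3<n)
  where
  leading : f̄ a ≈₃ f̄ (+ 1) ⊎ f̄ a ≈₃ f̄ (+ 2) → f̄ a 3 ≢ 𝟘
  leading (inj₁ f̄a≈f̄1) f̄a3≡0 with trans (sym (f̄a≈f̄1 3)) f̄a3≡0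
  ... | ()
  leading (inj₂ f̄a≈f̄2) f̄a3≡0 with trans (sym (f̄a≈f̄2 3)) f̄a3≡0
  ... | ()

f-degree : ∀ a → ¬ (+ 3 ∣ a) → HasDegreeℤ (f a) 3
f-degree a 3∤a = (λ fa3≡0 → proj₁ (f̄-degree a 3∤a) (cong reduceℤ fa3≡0)) , f-vanishesAbove-3 a

*≡1⇒square≡1 : ∀ c z → c * z ≡ + 1 → c * c ≡ + 1
*≡1⇒square≡1 c z c*z≡1
  with ℕP.m*n≡1⇒m≡1 ℤ.∣ c ∣ ℤ.∣ z ∣ (trans (sym (ℤP.abs-* c z)) (cong ℤ.∣_∣ c*z≡1))
*≡1⇒square≡1 (+ 1)    _ _ | _ = refl
*≡1⇒square≡1 -[1+ 0 ] _ _ | _ = refl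

f-primitive : ∀ a → Primitive (f a)
f-primitive a c h fa≡ch = *≡1⇒square≡1 c (+ 4 * h 0 - h 1) (begin
  c * (+ 4 * h 0 - h 1)     ≡⟨ distribute c (h 0) (h 1) ⟩
  + 4 * (c * h 0) - c * h 1 ≡⟨ cong₂ (λ u v → + 4 * u - v) (fa≡ch 0) (fa≡ch 1) ⟨
  + 4 * a - (+ 4 * a - + 1) ≡⟨ cancel a ⟩
  + 1                       ∎)
  where
  open ≡-Reasoning
  distribute : ∀ c x y → c * (+ 4 * x - y) ≡ + 4 * (c * x) - c * y
  distribute = solve-∀
  cancel : ∀ a → + 4 * a - (+ 4 * a - + 1) ≡ + 1
  cancel = solve-∀

theorem2p1 : (a : ℤ) → ¬ (+ 3 ∣ a) →
    ℤ/3[x].Irreducible (f̄ a) × ℤ[x].Irreducible (f a)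
theorem2p1 a 3∤a =
  f̄-irreducible ,
  Reduction.irreducible (f-primitive a) (f-degree a 3∤a) (f̄-degree a 3∤a) f̄-irreducible
  where
  f̄-irreducible : ℤ/3[x].Irreducible (f̄ a)
  f̄-irreducible = Cubic.irreducible (f̄-quadraticSplittingsTrivial a 3∤a) (f̄-degree a 3∤a)
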